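{- Let $\mathcal P$ be the Petersen graph on a $10$-element vertex set $H$, and in $\mathbb{Q}[\ell_b:b\in H]$ let $\mathcal I$ be the ideal generated by the ten linear forms $\ell_b-\sum_{a\sim b}\ell_a$. Then the quadratic polynomial $$\mathcal T_2:=13\sum_{\{a,b\}\text{ edge}}\ell_a\ell_b+11\sum_{\{a,b\}\text{ non-edge},\,a\neq b}\ell_a\ell_b$$ does not lie in $\mathcal I$.
   Context: $\mathcal T_2$ is (up to an overall factor) the degree-$2$ part in the $\ell$-variables of the paper's Jack Littlewood–Richardson polynomial for $(21,21,321)$, whose weight on a monomial $\beta^{10-|I|}\ell_I$ is $2e_{H\setminus I}-|H\setminus I|+1$ with $e_J$ the number of edges inside $J$; the quotient $\mathbb{Q}[\ell]/\mathcal I$ is the symmetric algebra of the eigenvalue-$1$ eigenspace $V_{32}$ of the adjacency operator. In contrast with the odd degree parts, this even degree part does not vanish in the hook space. -}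

module Defs where

open import Data.Nat as ℕ using (ℕ)
open import Data.Integer using (+_)
open import Data.Rational using (ℚ; _/_; 0ℚ; 1ℚ; -_) renaming (_+_ to _+ℚ_; _*_ to _*ℚ_)
open import Data.Fin using (Fin; toℕ)
open import Data.Fin.Properties using () renaming (_≟_ to _≟F_)
open import Data.Vec using (Vec; _∷_; []; lookup; tabulate; zipWith)
open import Data.Vec.Properties using (≡-dec)
open import Data.List using (List; _∷_; []; _++_; concatMap; map; foldr; allFin; filter)
open import Data.Product using (Σ; _×_; _,_; proj₁; proj₂)
open import Data.Bool using (Bool; true; false; if_then_else_; _∧_; not)
open import Relation.Nullary using (Dec; yes; no)
open import Relation.Nullary.Decidable using (⌊_⌋)
open import Data.Bool.Properties using () renaming (_≟_ to _≟B_)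
open import Relation.Binary.PropositionalEquality using (_≡_)

H : Set
H = Fin 10

-- Petersen graph as the Kneser graph K(5,2): vertices are the 2-subsets of
-- {0,...,4}, two vertices adjacent iff the 2-subsets are disjoint.
pairOf : H → ℕ × ℕ
pairOf v = lookup ((0 , 1) ∷ (0 , 2) ∷ (0 , 3) ∷ (0 , 4) ∷ (1 , 2) ∷
                   (1 , 3) ∷ (1 , 4) ∷ (2 , 3) ∷ (2 , 4) ∷ (3 , 4) ∷ []) v

private
  eqℕ : ℕ → ℕ → Bool
  eqℕ m n = ⌊ m ℕ.≟ n ⌋

adj : H → H → Bool
adj a b with pairOf a | pairOf b
... | (i , j) | (k , l) = not (eqℕ i k) ∧ not (eqℕ i l) ∧ not (eqℕ j k) ∧ not (eqℕ j l)

-- A monomial is an exponent vector; a polynomial is a finite formal sum of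
-- terms (coefficient, monomial).
Mono : Set
Mono = Vec ℕ 10

Poly : Set
Poly = List (ℚ × Mono)

coeff : Poly → Mono → ℚ
coeff [] m = 0ℚ
coeff ((c , m') ∷ p) m with ≡-dec ℕ._≟_ m' m
... | yes _ = c +ℚ coeff p m
... | no  _ = coeff p m

_≈P_ : Poly → Poly → Set
p ≈P q = (m : Mono) → coeff p m ≡ coeff q m

zeroP : Poly
zeroP = []

_+P_ : Poly → Poly → Poly
p +P q = p ++ q

_*P_ : Poly → Poly → Poly
p *P q = concatMap (λ t → map (λ s → (proj₁ t *ℚ proj₁ s , zipWith ℕ._+_ (proj₂ t) (proj₂ s))) q) p

scale : ℚ → Poly → Poly
scale c p = map (λ t → (c *ℚ proj₁ t , proj₂ t)) p

sumP : List Poly → Poly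
sumP = foldr _+P_ zeroP

ℓ : H → Poly
ℓ b = (1ℚ , tabulate (λ a → if ⌊ a ≟F b ⌋ then 1 else 0)) ∷ []

L : H → Poly
L b = ℓ b +P scale (- 1ℚ) (sumP (map ℓ (filter (λ a → adj a b ≟B true) (allFin 10))))

_∈𝓘 : Poly → Set
f ∈𝓘 = Σ (H → Poly) λ g → f ≈P sumP (map (λ b → g b *P L b) (allFin 10))

pairsH : List (H × H)
pairsH = filter (λ ab → toℕ (proj₁ ab) ℕ.<? toℕ (proj₂ ab))
                (concatMap (λ a → map (λ b → (a , b)) (allFin 10)) (allFin 10))

𝓣₂ : Poly
𝓣₂ = scale (+ 13 / 1) (sumP (map (λ ab → ℓ (proj₁ ab) *P ℓ (proj₂ ab))
                         (filter (λ ab → adj (proj₁ ab) (proj₂ ab) ≟B true) pairsH)))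
   +P scale (+ 11 / 1) (sumP (map (λ ab → ℓ (proj₁ ab) *P ℓ (proj₂ ab))
                         (filter (λ ab → adj (proj₁ ab) (proj₂ ab) ≟B false) pairsH)))

{-# OPTIONS --safe #-}
module Submission where

-- Evaluation at a point ξ is a ring homomorphism ℚ[ℓ] → ℚ, and L b evaluates to (ξ − Aξ)_b for the
-- adjacency operator A.  So at an eigenvector ξ of A with eigenvalue 1 every element of 𝓘 vanishes,
-- whereas 𝓣₂ evaluates to −45 at the eigenvector ξ chosen below.

open import Defs
open import Relation.Nullary using (¬_; Dec; yes; no)

open import Data.Nat as ℕ using (ℕ)
import Data.Integer as ℤ
open import Data.Rational using (ℚ; 0ℚ; 1ℚ; -_; _/_; _+_; _*_)
open import Data.Rational.Properties
  using (_≟_; +-identityˡ; +-identityʳ; +-assoc; *-identityˡ; *-zeroˡ; *-zeroʳ; *-distribʳ-+; *-distribˡ-+;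
         +-0-commutativeMonoid; *-1-commutativeMonoid; +-*-commutativeRing)
open import Algebra.Bundles using (CommutativeMonoid; CommutativeRing)
open import Algebra.Properties.Semiring.Exp (CommutativeRing.semiring +-*-commutativeRing)
  using (_^_; ^-homo-*)
import Algebra.Properties.CommutativeSemigroup as CommutativeSemigroupProperties
open import Data.Fin.Properties using (all?)
open import Data.Vec using (Vec; _∷_; []; zipWith)
open import Data.Vec.Properties using (≡-dec)
open import Data.List using (List; _∷_; []; _++_; map; allFin; deduplicate)
open import Data.List.Membership.Propositional using (_∈_)
open import Data.List.Membership.Propositional.Properties using (∈-++⁺ˡ; ∈-++⁺ʳ; ∈-deduplicate⁺)
open import Data.List.Relation.Unary.All as All using (All; _∷_; [])
open import Data.List.Relation.Unary.Any using (here; there)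
open import Data.List.Relation.Unary.Unique.Propositional using (Unique; _∷_)
open import Data.List.Relation.Unary.Unique.DecPropositional.Properties using (deduplicate-!)
open import Data.Product using (_×_; _,_; proj₁; proj₂)
open import Function using (_∘_)
open import Data.Empty using (⊥-elim)
open import Relation.Nullary.Decidable using (toWitness)
open import Relation.Binary.PropositionalEquality
open ≡-Reasoning

open CommutativeSemigroupProperties (CommutativeMonoid.commutativeSemigroup *-1-commutativeMonoid)
  using () renaming (interchange to *-interchange)
open CommutativeSemigroupProperties (CommutativeMonoid.commutativeSemigroup +-0-commutativeMonoid)
  using () renaming (interchange to +-interchange)

monomial : ∀ {n} → Vec ℚ n → Vec ℕ n → ℚ
monomial []      []      = 1ℚ
monomial (a ∷ x) (k ∷ m) = a ^ k * monomial x m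

monomial-zipWith-+ : ∀ {n} (x : Vec ℚ n) (m m′ : Vec ℕ n) →
                     monomial x (zipWith ℕ._+_ m m′) ≡ monomial x m * monomial x m′
monomial-zipWith-+ []      []      []        = sym (*-identityˡ 1ℚ)
monomial-zipWith-+ (a ∷ x) (k ∷ m) (k′ ∷ m′) = begin
  a ^ (k ℕ.+ k′) * monomial x (zipWith ℕ._+_ m m′)
    ≡⟨ cong₂ _*_ (^-homo-* a k k′) (monomial-zipWith-+ x m m′) ⟩
  (a ^ k * a ^ k′) * (monomial x m * monomial x m′)
    ≡⟨ *-interchange (a ^ k) (a ^ k′) (monomial x m) (monomial x m′) ⟩
  (a ^ k * monomial x m) * (a ^ k′ * monomial x m′) ∎

eval : Vec ℚ 10 → Poly → ℚ
eval x []            = 0ℚ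
eval x ((c , m) ∷ p) = c * monomial x m + eval x p

eval-+P : ∀ x p q → eval x (p +P q) ≡ eval x p + eval x q
eval-+P x []            q = sym (+-identityˡ (eval x q))
eval-+P x ((c , m) ∷ p) q =
  trans (cong ((c * monomial x m) +_) (eval-+P x p q)) (sym (+-assoc (c * monomial x m) (eval x p) (eval x q)))

termTimes : ℚ × Mono → Poly → Poly
termTimes (c , m) = map (λ s → (c * proj₁ s , zipWith ℕ._+_ m (proj₂ s)))

eval-termTimes : ∀ x c m q → eval x (termTimes (c , m) q) ≡ (c * monomial x m) * eval x q
eval-termTimes x c m []             = sym (*-zeroʳ (c * monomial x m))
eval-termTimes x c m ((d , m′) ∷ q) = begin
  (c * d) * monomial x (zipWith ℕ._+_ m m′) + eval x (termTimes (c , m) q)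
    ≡⟨ cong₂ _+_ (cong ((c * d) *_) (monomial-zipWith-+ x m m′)) (eval-termTimes x c m q) ⟩
  (c * d) * (monomial x m * monomial x m′) + (c * monomial x m) * eval x q
    ≡⟨ cong (_+ (c * monomial x m) * eval x q) (*-interchange c d (monomial x m) (monomial x m′)) ⟩
  (c * monomial x m) * (d * monomial x m′) + (c * monomial x m) * eval x q
    ≡⟨ sym (*-distribˡ-+ (c * monomial x m) _ (eval x q)) ⟩
  (c * monomial x m) * (d * monomial x m′ + eval x q) ∎

eval-*P : ∀ x p q → eval x (p *P q) ≡ eval x p * eval x q
eval-*P x []            q = sym (*-zeroˡ (eval x q))
eval-*P x ((c , m) ∷ p) q = begin
  eval x (termTimes (c , m) q +P (p *P q))
    ≡⟨ eval-+P x (termTimes (c , m) q) (p *P q) ⟩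
  eval x (termTimes (c , m) q) + eval x (p *P q)
    ≡⟨ cong₂ _+_ (eval-termTimes x c m q) (eval-*P x p q) ⟩
  (c * monomial x m) * eval x q + eval x p * eval x q
    ≡⟨ sym (*-distribʳ-+ (eval x q) (c * monomial x m) (eval x p)) ⟩
  (c * monomial x m + eval x p) * eval x q ∎

_≟M_ : (m m′ : Mono) → Dec (m ≡ m′)
_≟M_ = ≡-dec ℕ._≟_

coeff-++ : ∀ p q m → coeff (p ++ q) m ≡ coeff p m + coeff q m
coeff-++ []             q m = sym (+-identityˡ (coeff q m))
coeff-++ ((c , m′) ∷ p) q m with m′ ≟M m
... | yes _ = trans (cong (c +_) (coeff-++ p q m)) (sym (+-assoc c (coeff p m) (coeff q m)))
... | no  _ = coeff-++ p q m

coeff-singleton-≡ : ∀ c m → coeff ((c , m) ∷ []) m ≡ c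
coeff-singleton-≡ c m with m ≟M m
... | yes _  = +-identityʳ c
... | no m≢m = ⊥-elim (m≢m refl)

coeff-singleton-≢ : ∀ c {m′ m} → m′ ≢ m → coeff ((c , m′) ∷ []) m ≡ 0ℚ
coeff-singleton-≢ c {m′} {m} m′≢m with m′ ≟M m
... | yes m′≡m = ⊥-elim (m′≢m m′≡m)
... | no  _    = refl

∑ : {A : Set} → List A → (A → ℚ) → ℚ
∑ []       f = 0ℚ
∑ (a ∷ as) f = f a + ∑ as f

∑-cong : ∀ {A : Set} (as : List A) {f g : A → ℚ} → (∀ a → f a ≡ g a) → ∑ as f ≡ ∑ as g
∑-cong []       f≗g = refl
∑-cong (a ∷ as) f≗g = cong₂ _+_ (f≗g a) (∑-cong as f≗g)

∑-+ : ∀ {A : Set} (as : List A) (f g : A → ℚ) → ∑ as (λ a → f a + g a) ≡ ∑ as f + ∑ as g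
∑-+ []       f g = sym (+-identityˡ 0ℚ)
∑-+ (a ∷ as) f g =
  trans (cong (f a + g a +_) (∑-+ as f g)) (+-interchange (f a) (g a) (∑ as f) (∑ as g))

∑-zero : ∀ {A : Set} {as : List A} {f : A → ℚ} → All (λ a → f a ≡ 0ℚ) as → ∑ as f ≡ 0ℚ
∑-zero []              = refl
∑-zero (fa≡0 ∷ fas≡0) = trans (cong₂ _+_ fa≡0 (∑-zero fas≡0)) (+-identityˡ 0ℚ)

∑-pointSupported : ∀ {A : Set} {as : List A} {a : A} (f : A → ℚ) →
                   Unique as → a ∈ as → (∀ b → b ≢ a → f b ≡ 0ℚ) → ∑ as f ≡ f a
∑-pointSupported f (a≢as ∷ _) (here refl) f-supp =
  trans (cong (f _ +_) (∑-zero (All.map (λ a≢b → f-supp _ (a≢b ∘ sym)) a≢as))) (+-identityʳ _)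
∑-pointSupported f (b≢as ∷ !as) (there a∈as) f-supp =
  trans (cong₂ _+_ (f-supp _ (λ b≡a → All.lookup b≢as a∈as b≡a)) (∑-pointSupported f !as a∈as f-supp))
        (+-identityˡ _)

-- Evaluation through the coefficients only, hence compatible with _≈P_.
coeffSum : Vec ℚ 10 → List Mono → Poly → ℚ
coeffSum x M p = ∑ M (λ m → coeff p m * monomial x m)

coeffSum-cong : ∀ x M {p q} → p ≈P q → coeffSum x M p ≡ coeffSum x M q
coeffSum-cong x M p≈q = ∑-cong M (λ m → cong (_* monomial x m) (p≈q m))

coeffSum-++ : ∀ x M p q → coeffSum x M (p ++ q) ≡ coeffSum x M p + coeffSum x M q
coeffSum-++ x M p q = trans (∑-cong M distrib) (∑-+ M _ _)
  where
  distrib : ∀ m → coeff (p ++ q) m * monomial x m ≡ coeff p m * monomial x m + coeff q m * monomial x m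
  distrib m = trans (cong (_* monomial x m) (coeff-++ p q m)) (*-distribʳ-+ (monomial x m) (coeff p m) (coeff q m))

coeffSum-singleton : ∀ x {M} c {m} → Unique M → m ∈ M → coeffSum x M ((c , m) ∷ []) ≡ c * monomial x m
coeffSum-singleton x c {m} !M m∈M =
  trans (∑-pointSupported (λ b → coeff ((c , m) ∷ []) b * monomial x b) !M m∈M vanishes-off-m)
        (cong (_* monomial x m) (coeff-singleton-≡ c m))
  where
  vanishes-off-m : ∀ b → b ≢ m → coeff ((c , m) ∷ []) b * monomial x b ≡ 0ℚ
  vanishes-off-m b b≢m = trans (cong (_* monomial x b) (coeff-singleton-≢ c (b≢m ∘ sym))) (*-zeroˡ (monomial x b))

eval≡coeffSum : ∀ x {M} p → Unique M → (∀ {m} → m ∈ map proj₂ p → m ∈ M) → eval x p ≡ coeffSum x M p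
eval≡coeffSum x {M} []            !M p⊆M = sym (∑-zero (All.universal (λ m → *-zeroˡ (monomial x m)) M))
eval≡coeffSum x {M} ((c , m) ∷ p) !M p⊆M = begin
  c * monomial x m + eval x p
    ≡⟨ cong₂ _+_ (sym (coeffSum-singleton x c !M (p⊆M (here refl))))
                 (eval≡coeffSum x p !M (λ m∈p → p⊆M (there m∈p))) ⟩
  coeffSum x M ((c , m) ∷ []) + coeffSum x M p
    ≡⟨ sym (coeffSum-++ x M ((c , m) ∷ []) p) ⟩
  coeffSum x M ((c , m) ∷ p) ∎

eval-cong : ∀ x {p q} → p ≈P q → eval x p ≡ eval x q
eval-cong x {p} {q} p≈q = begin
  eval x p       ≡⟨ eval≡coeffSum x p !M (λ m∈p → ∈-deduplicate⁺ _≟M_ (∈-++⁺ˡ m∈p)) ⟩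
  coeffSum x M p ≡⟨ coeffSum-cong x M {p} {q} p≈q ⟩
  coeffSum x M q ≡⟨ sym (eval≡coeffSum x q !M (λ m∈q → ∈-deduplicate⁺ _≟M_ (∈-++⁺ʳ (map proj₂ p) m∈q))) ⟩
  eval x q       ∎
  where
  monomials : List Mono
  monomials = map proj₂ p ++ map proj₂ q

  M : List Mono
  M = deduplicate _≟M_ monomials

  !M : Unique M
  !M = deduplicate-! _≟M_ monomials

eval-combination≡0 : ∀ x (f g : H → Poly) → (∀ b → eval x (f b) ≡ 0ℚ) →
                     ∀ bs → eval x (sumP (map (λ b → g b *P f b) bs)) ≡ 0ℚ
eval-combination≡0 x f g f≡0 []       = refl
eval-combination≡0 x f g f≡0 (b ∷ bs) = begin
  eval x ((g b *P f b) +P sumP (map (λ b → g b *P f b) bs))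
    ≡⟨ eval-+P x (g b *P f b) _ ⟩
  eval x (g b *P f b) + eval x (sumP (map (λ b → g b *P f b) bs))
    ≡⟨ cong₂ _+_ (eval-*P x (g b) (f b)) (eval-combination≡0 x f g f≡0 bs) ⟩
  eval x (g b) * eval x (f b) + 0ℚ
    ≡⟨ cong (λ y → eval x (g b) * y + 0ℚ) (f≡0 b) ⟩
  eval x (g b) * 0ℚ + 0ℚ
    ≡⟨ trans (+-identityʳ _) (*-zeroʳ (eval x (g b))) ⟩
  0ℚ ∎

eval-∈𝓘 : ∀ x → (∀ b → eval x (L b) ≡ 0ℚ) → ∀ {p} → p ∈𝓘 → eval x p ≡ 0ℚ
eval-∈𝓘 x L≡0 {p} (g , p≈) = begin
  eval x p                 ≡⟨ eval-cong x {p} {ideal-combination} p≈ ⟩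
  eval x ideal-combination ≡⟨ eval-combination≡0 x L g L≡0 (allFin 10) ⟩
  0ℚ                       ∎
  where
  ideal-combination : Poly
  ideal-combination = sumP (map (λ b → g b *P L b) (allFin 10))

ξ : Vec ℚ 10
ξ = - 1ℚ ∷ - 1ℚ ∷ 1ℚ ∷ 1ℚ ∷ 1ℚ ∷ - 1ℚ ∷ 1ℚ ∷ 1ℚ ∷ - 1ℚ ∷ - 1ℚ ∷ []

eval-L-ξ : ∀ b → eval ξ (L b) ≡ 0ℚ
eval-L-ξ = toWitness {a? = all? (λ b → eval ξ (L b) ≟ 0ℚ)} _

eval-𝓣₂-ξ : eval ξ 𝓣₂ ≡ - (ℤ.+ 45 / 1)
eval-𝓣₂-ξ = refl

mainTheorem12 : ¬ (𝓣₂ ∈𝓘)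
mainTheorem12 𝓣₂∈𝓘 = -45≢0 (trans (sym eval-𝓣₂-ξ) (eval-∈𝓘 ξ eval-L-ξ {𝓣₂} 𝓣₂∈𝓘))
  where
  -45≢0 : - (ℤ.+ 45 / 1) ≢ 0ℚ
  -45≢0 ()
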